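{- Let $p$ be a prime and let $a,m$ be integers with $a>0$ and $p\nmid m$. Then $$\sum_{k=1}^{p^a-1}\frac{\binom{2k}{k+1}}{m^k}+(m^{p-1}-1)\equiv\frac{m-2}2\sum_{k=1}^{p^a-1}\frac{\binom{2k}k}{m^k}+p\,\delta_{p,2}\pmod{p^2}.$$
   Context: $\delta_{p,2}$ is the Kronecker delta ($1$ if $p=2$, $0$ otherwise). Congruences between rational numbers are understood in the ring of rationals whose denominators are prime to $p$ (note $\binom{2k}k$ is even for $k\ge1$). -}

module Defs where

open import Data.Nat as ℕ using (ℕ; zero; suc)
open import Data.Nat.Combinatorics using (_C_)
open import Data.Nat.Divisibility using (_∣_)
open import Data.Integer as ℤ using (ℤ; +_; -[1+_])
open import Data.Rational as ℚ using (ℚ; _/_; 0ℚ)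
open import Data.Product using (∃; ∃₂; _×_)
open import Relation.Binary.PropositionalEquality using (_≡_)
open import Relation.Nullary using (¬_)

-- Division of an integer by an integer, as a rational number.
-- (Convention: division by 0 yields 0; never used below since p ∤ m forces m ≠ 0.)
_÷ℤ_ : ℤ → ℤ → ℚ
n ÷ℤ (+ zero) = 0ℚ
n ÷ℤ (+ suc d) = n / suc d
n ÷ℤ -[1+ d ] = (ℤ.- n) / suc d

sumFrom1 : ℕ → (ℕ → ℚ) → ℚ
sumFrom1 zero f = 0ℚ
sumFrom1 (suc N) f = sumFrom1 N f ℚ.+ f (suc N)

δ2 : ℕ → ℤ
δ2 2 = + 1
δ2 _ = + 0

-- Congruence of rationals modulo an integer n, in the ring Z_(p) of rationals
-- whose denominators are prime to p:  x ≡ y (mod n)  iff  x - y = n·c/d with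
-- c ∈ ℤ and d ∈ ℕ, d ≠ 0, p ∤ d.
CongModIn : (p : ℕ) (n : ℤ) (x y : ℚ) → Set
CongModIn p n x y =
  ∃₂ λ (c : ℤ) (d : ℕ) → (¬ (p ∣ suc d)) × (x ℚ.- y ≡ (n ℤ.* c) / suc d)

module Submission where

-- Write c_k = C(2k,k), d_k = C(2k,k+1), u = m^(p-1) and h = C(2n+1,n).
-- (1) Telescoping (modules IntegerEmbedding, Telescoping).  Pascal's rule gives
--     c_{k+1} = 2(c_k + d_k); summed against the weights m^(-k) this telescopes, and the
--     difference of the two sides is exactly (h + (u - 2 - pδ)·m^n) / m^n, as c_{n+1} = 2h.
-- (2) Central binomial coefficients (module BinomialCoefficients).  By Vandermonde's identity
--     C(2N,N), N = p^a, is 2 plus products C(N,i)·C(N,N-i), 0 < i < N, each divisible by p²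
--     since p ∣ C(N,i) (a valuation count based on k·C(N,k) = N·C(N-1,k-1)); for p = 2 a finer
--     count gives C(2N,N) ≡ 6 (mod 8).  As C(2N,N) = 2h, this yields h ≡ 1 + pδ (mod p²).
-- (3) Fermat and lifting (module IntegerCongruences).  u ≡ 1 (mod p) by Fermat's little theorem
--     (via the binomial theorem), hence u^p ≡ 1 and m^n ≡ u (mod p²).
-- (4) So h + (u - 2 - pδ)·m^n ≡ (u - 1)(u - 1 - pδ) ≡ 0 (mod p²); as p ∤ m^n, the difference
--     of the two sides is p² times an element of ℤ_(p).

module BinomialCoefficients where

  open import Data.Nat using (ℕ; zero; suc; _+_; _*_; _∸_; _^_; _≤_; _<_; z≤n; s≤s; nonTrivial⇒n>1)
  open import Data.Nat.Properties
  open import Data.Nat.Combinatorics using (_C_; k>n⇒nCk≡0; nCn≡1; nC1≡n; nCk≡nC[n∸k]; nCk+nC[k+1]≡[n+1]C[k+1])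
  open import Data.Nat.Divisibility
  open import Data.Nat.Primality using (Prime; euclidsLemma; prime⇒nonZero; prime⇒nonTrivial; prime⇒irreducible; prime[2])
  open import Data.Nat.Solver using (module +-*-Solver)
  open +-*-Solver using (solve; _:=_; _:+_; _:*_; con)
  open import Data.Product using (∃; _,_; proj₁; proj₂)
  open import Data.Sum using (inj₁; inj₂; [_,_]′; reduce)
  open import Function using (id)
  open import Data.Empty using (⊥-elim)
  open import Relation.Nullary using (¬_; yes; no)
  open import Relation.Binary.PropositionalEquality
  open ≡-Reasoning

  pascal : ∀ n k → suc n C suc k ≡ n C k + n C suc k
  pascal n k = sym (nCk+nC[k+1]≡[n+1]C[k+1] n k)

  absorption : ∀ n k → suc k * (suc n C suc k) ≡ suc n * (n C k)
  absorption zero zero = refl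
  absorption zero (suc k) = *-zeroʳ (suc (suc k))
  absorption (suc n) zero = trans (*-identityˡ _) (trans (nC1≡n (suc (suc n))) (sym (*-identityʳ _)))
  absorption (suc n) (suc k) = begin
      suc (suc k) * (suc (suc n) C suc (suc k))
    ≡⟨ cong (suc (suc k) *_) (pascal (suc n) (suc k)) ⟩
      suc (suc k) * (A + B)
    ≡⟨ *-distribˡ-+ (suc (suc k)) A B ⟩
      suc (suc k) * A + suc (suc k) * B
    ≡⟨ cong (suc (suc k) * A +_) (absorption n (suc k)) ⟩
      A + suc k * A + suc n * (n C suc k)
    ≡⟨ cong (λ x → A + x + suc n * (n C suc k)) (absorption n k) ⟩
      A + suc n * (n C k) + suc n * (n C suc k)
    ≡⟨ solve 4 (λ a n x y → a :+ (con 1 :+ n) :* x :+ (con 1 :+ n) :* y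
                          := a :+ (con 1 :+ n) :* (x :+ y)) refl A n (n C k) (n C suc k) ⟩
      A + suc n * (n C k + n C suc k)
    ≡⟨ cong (λ x → A + suc n * x) (sym (pascal n k)) ⟩
      suc (suc n) * A ∎
    where
      A B : ℕ
      A = suc n C suc k
      B = suc n C suc (suc k)

  power-divides-power : ∀ p i j → p ^ i ∣ p ^ (j + i)
  power-divides-power p i j = divides (p ^ j) (^-distribˡ-+-* p j i)

  prime-power-cancel : ∀ {p B} → Prime p → ¬ p ∣ B → ∀ e k → p ^ e ∣ k * B → p ^ e ∣ k
  prime-power-cancel pr p∤B zero k _ = 1∣ k
  prime-power-cancel {p} {B} pr p∤B (suc e) k pᵉ⁺¹∣kB
    with euclidsLemma k B pr (∣-trans (m∣m*n (p ^ e)) pᵉ⁺¹∣kB)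
  ... | inj₂ p∣B = ⊥-elim (p∤B p∣B)
  ... | inj₁ (divides k′ refl) = subst (p ^ suc e ∣_) (*-comm p k′) (*-monoʳ-∣ p pᵉ∣k′)
    where
      instance _ = prime⇒nonZero pr
      pᵉ∣k′ : p ^ e ∣ k′
      pᵉ∣k′ = prime-power-cancel pr p∤B e k′ (*-cancelˡ-∣ p (subst (p ^ suc e ∣_)
                (solve 3 (λ k p b → k :* p :* b := p :* (k :* b)) refl k′ p B) pᵉ⁺¹∣kB))

  prime-power-split : ∀ {p} → Prime p → ∀ i j k B → p ^ (j + i) ∣ k * B → ¬ p ^ suc i ∣ k → p ^ j ∣ B
  prime-power-split pr i zero k B _ _ = 1∣ B
  prime-power-split {p} pr i (suc j) k B pʲ⁺ⁱ∣kB pⁱ⁺¹∤k with p ∣? B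
  ... | no p∤B = ⊥-elim (pⁱ⁺¹∤k (∣-trans pⁱ⁺¹∣pʲ⁺ⁱ⁺¹ (prime-power-cancel pr p∤B (suc (j + i)) k pʲ⁺ⁱ∣kB)))
    where
      pⁱ⁺¹∣pʲ⁺ⁱ⁺¹ : p ^ suc i ∣ p ^ suc (j + i)
      pⁱ⁺¹∣pʲ⁺ⁱ⁺¹ = subst (λ e → p ^ suc i ∣ p ^ e) (+-suc j i) (power-divides-power p (suc i) j)
  ... | yes (divides B′ refl) = subst (p ^ suc j ∣_) (*-comm p B′) (*-monoʳ-∣ p pʲ∣B′)
    where
      instance _ = prime⇒nonZero pr
      pʲ∣B′ : p ^ j ∣ B′
      pʲ∣B′ = prime-power-split pr i j k B′ (*-cancelˡ-∣ p (subst (p ^ suc (j + i) ∣_)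
                (solve 3 (λ k b p → k :* (b :* p) := p :* (k :* b)) refl k B′ p) pʲ⁺ⁱ∣kB)) pⁱ⁺¹∤k

  -- If p^(j+i) ∣ N while p^(i+1) ∤ k, then p^j ∣ C(N, k): by absorption
  -- k·C(N, k) = N·C(N-1, k-1) is divisible by p^(j+i).
  prime-power-binomial : ∀ {p} → Prime p → ∀ i j N k → p ^ (j + i) ∣ N → ¬ p ^ suc i ∣ k → p ^ j ∣ N C k
  prime-power-binomial pr i j N zero _ pⁱ⁺¹∤0 = ⊥-elim (pⁱ⁺¹∤0 (_ ∣0))
  prime-power-binomial pr i j zero (suc k) _ _ = _ ∣0
  prime-power-binomial {p} pr i j (suc n) (suc k) pʲ⁺ⁱ∣N pⁱ⁺¹∤k =
    prime-power-split pr i j (suc k) (suc n C suc k)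
      (subst (p ^ (j + i) ∣_) (sym (absorption n k)) (∣m⇒∣m*n (n C k) pʲ⁺ⁱ∣N)) pⁱ⁺¹∤k

  prime-divides-binomial : ∀ {p} → Prime p → ∀ a N k → N ≡ p ^ suc a → suc k < N → p ∣ N C suc k
  prime-divides-binomial {p} pr a N k refl k<N =
    ∣-trans (∣-reflexive (sym (*-identityʳ p)))
      (prime-power-binomial pr a 1 N (suc k) ∣-refl (λ N∣k → <⇒≱ k<N (∣⇒≤ N∣k)))

  sumTo : ℕ → (ℕ → ℕ) → ℕ
  sumTo zero F = F 0
  sumTo (suc r) F = F 0 + sumTo r (λ i → F (suc i))

  sumTo-cong : ∀ r {F G} → (∀ i → F i ≡ G i) → sumTo r F ≡ sumTo r G
  sumTo-cong zero F≡G = F≡G 0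
  sumTo-cong (suc r) F≡G = cong₂ _+_ (F≡G 0) (sumTo-cong r (λ i → F≡G (suc i)))

  sumTo-zero : ∀ r → sumTo r (λ _ → 0) ≡ 0
  sumTo-zero zero = refl
  sumTo-zero (suc r) = sumTo-zero r

  sumTo-+ : ∀ r F G → sumTo r (λ i → F i + G i) ≡ sumTo r F + sumTo r G
  sumTo-+ zero F G = refl
  sumTo-+ (suc r) F G = trans (cong (F 0 + G 0 +_) (sumTo-+ r (λ i → F (suc i)) (λ i → G (suc i))))
    (solve 4 (λ a b c d → a :+ b :+ (c :+ d) := a :+ c :+ (b :+ d)) refl (F 0) (G 0) _ _)

  sumTo-*ˡ : ∀ r x F → sumTo r (λ i → x * F i) ≡ x * sumTo r F
  sumTo-*ˡ zero x F = refl
  sumTo-*ˡ (suc r) x F = trans (cong (x * F 0 +_) (sumTo-*ˡ r x (λ i → F (suc i))))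
    (sym (*-distribˡ-+ x (F 0) _))

  sumTo-last : ∀ r F → sumTo (suc r) F ≡ sumTo r F + F (suc r)
  sumTo-last zero F = refl
  sumTo-last (suc r) F = trans (cong (F 0 +_) (sumTo-last r (λ i → F (suc i)))) (sym (+-assoc (F 0) _ _))

  ∣-sumTo : ∀ {q} r F → (∀ i → i ≤ r → q ∣ F i) → q ∣ sumTo r F
  ∣-sumTo zero F q∣F = q∣F 0 z≤n
  ∣-sumTo (suc r) F q∣F =
    ∣m∣n⇒∣m+n (q∣F 0 z≤n) (∣-sumTo r (λ i → F (suc i)) (λ i i≤r → q∣F (suc i) (s≤s i≤r)))

  sumTo-single : ∀ {q} r F i₀ → i₀ ≤ r → (∀ i → i ≤ r → i ≢ i₀ → q ∣ F i) →
    ∃ λ t → sumTo r F ≡ F i₀ + t * q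
  sumTo-single zero F zero _ _ = 0 , sym (+-identityʳ (F 0))
  sumTo-single (suc r) F zero _ q∣F with ∣-sumTo r (λ i → F (suc i)) (λ i i≤r → q∣F (suc i) (s≤s i≤r) (λ ()))
  ... | divides t eq = t , cong (F 0 +_) eq
  sumTo-single {q} (suc r) F (suc i₀) (s≤s i₀≤r) q∣F
    with q∣F 0 z≤n (λ ()) | sumTo-single r (λ i → F (suc i)) i₀ i₀≤r
                               (λ i i≤r i≢i₀ → q∣F (suc i) (s≤s i≤r) (λ eq → i≢i₀ (suc-injective eq)))
  ... | divides t₀ eq₀ | t , eq = t₀ + t , (begin
      F 0 + sumTo r (λ i → F (suc i))
    ≡⟨ cong₂ _+_ eq₀ eq ⟩
      t₀ * q + (F (suc i₀) + t * q)
    ≡⟨ solve 4 (λ a q x b → a :* q :+ (x :+ b :* q) := x :+ (a :+ b) :* q) refl t₀ q (F (suc i₀)) t ⟩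
      F (suc i₀) + (t₀ + t) * q ∎)

  vandermonde : ∀ a b r → (a + b) C r ≡ sumTo r (λ i → (a C i) * (b C (r ∸ i)))
  vandermonde zero b zero = refl
  vandermonde zero b (suc r) = sym (trans (cong (1 * (b C suc r) +_) (sumTo-zero r)) (trans (+-identityʳ _) (*-identityˡ _)))
  vandermonde (suc a) b zero = refl
  vandermonde (suc a) b (suc r) = begin
      suc (a + b) C suc r
    ≡⟨ pascal (a + b) r ⟩
      (a + b) C r + (a + b) C suc r
    ≡⟨ cong₂ _+_ (vandermonde a b r) (vandermonde a b (suc r)) ⟩
      S + (1 * (b C suc r) + T)
    ≡⟨ solve 3 (λ s y t → s :+ (y :+ t) := y :+ (s :+ t)) refl S (1 * (b C suc r)) T ⟩
      1 * (b C suc r) + (S + T)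
    ≡⟨ cong (1 * (b C suc r) +_) (sym (sumTo-+ r (λ i → (a C i) * (b C (r ∸ i))) (λ i → (a C suc i) * (b C (r ∸ i))))) ⟩
      1 * (b C suc r) + sumTo r (λ i → (a C i) * (b C (r ∸ i)) + (a C suc i) * (b C (r ∸ i)))
    ≡⟨ cong (1 * (b C suc r) +_) (sumTo-cong r (λ i → trans (sym (*-distribʳ-+ (b C (r ∸ i)) (a C i) (a C suc i)))
                                                          (cong (_* (b C (r ∸ i))) (sym (pascal a i))))) ⟩
      1 * (b C suc r) + sumTo r (λ i → (suc a C suc i) * (b C (r ∸ i))) ∎
    where
      S T : ℕ
      S = sumTo r (λ i → (a C i) * (b C (r ∸ i)))
      T = sumTo r (λ i → (a C suc i) * (b C (r ∸ i)))

  binomial-theorem : ∀ x n → (1 + x) ^ n ≡ sumTo n (λ i → (n C i) * x ^ i)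
  binomial-theorem x zero = refl
  binomial-theorem x (suc n) = begin
      (1 + x) * (1 + x) ^ n
    ≡⟨ cong ((1 + x) *_) (binomial-theorem x n) ⟩
      (1 + x) * S
    ≡⟨ solve 2 (λ x s → (con 1 :+ x) :* s := x :* s :+ (s :+ con 0)) refl x S ⟩
      x * S + (S + 0)
    ≡⟨ cong (λ y → x * S + (S + y * x ^ suc n)) (sym (k>n⇒nCk≡0 (n<1+n n))) ⟩
      x * S + (S + B (suc n))
    ≡⟨ cong (x * S +_) (sym (sumTo-last n B)) ⟩
      x * S + (1 * 1 + sumTo n (λ i → B (suc i)))
    ≡⟨ solve 3 (λ a b c → a :+ (b :+ c) := b :+ (a :+ c)) refl (x * S) (1 * 1) _ ⟩
      1 * 1 + (x * S + sumTo n (λ i → B (suc i)))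
    ≡⟨ cong (λ y → 1 * 1 + (y + sumTo n (λ i → B (suc i)))) (sym (sumTo-*ˡ n x B)) ⟩
      1 * 1 + (sumTo n (λ i → x * B i) + sumTo n (λ i → B (suc i)))
    ≡⟨ cong (1 * 1 +_) (sym (sumTo-+ n (λ i → x * B i) (λ i → B (suc i)))) ⟩
      1 * 1 + sumTo n (λ i → x * B i + B (suc i))
    ≡⟨ cong (1 * 1 +_) (sumTo-cong n pascal-term) ⟩
      1 * 1 + sumTo n (λ i → (suc n C suc i) * x ^ suc i) ∎
    where
      B : ℕ → ℕ
      B i = (n C i) * x ^ i
      S : ℕ
      S = sumTo n B
      pascal-term : ∀ i → x * B i + B (suc i) ≡ (suc n C suc i) * x ^ suc i
      pascal-term i = trans (solve 4 (λ x a b y → x :* (a :* y) :+ b :* (x :* y) := (a :+ b) :* (x :* y))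
                                    refl x (n C i) (n C suc i) (x ^ i))
                            (cong (_* x ^ suc i) (sym (pascal n i)))

  odd-symmetry : ∀ k → suc (2 * k) C k ≡ suc (2 * k) C suc k
  odd-symmetry k = trans (nCk≡nC[n∸k] k≤2k+1) (cong (suc (2 * k) C_) 2k+1∸k≡k+1)
    where
      2k+1≡ : k + suc k ≡ suc (2 * k)
      2k+1≡ = solve 1 (λ k → k :+ (con 1 :+ k) := con 1 :+ con 2 :* k) refl k
      k≤2k+1 : k ≤ suc (2 * k)
      k≤2k+1 = subst (k ≤_) 2k+1≡ (m≤m+n k (suc k))
      2k+1∸k≡k+1 : suc (2 * k) ∸ k ≡ suc k
      2k+1∸k≡k+1 = subst (λ n → n ∸ k ≡ suc k) 2k+1≡ (m+n∸m≡n k (suc k))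

  central-halving : ∀ k → (2 * suc k) C suc k ≡ 2 * (suc (2 * k) C k)
  central-halving k = begin
      (2 * suc k) C suc k
    ≡⟨ cong (_C suc k) (*-suc 2 k) ⟩
      suc (suc (2 * k)) C suc k
    ≡⟨ pascal (suc (2 * k)) k ⟩
      h + suc (2 * k) C suc k
    ≡⟨ cong (h +_) (sym (odd-symmetry k)) ⟩
      h + h
    ≡⟨ cong (h +_) (sym (+-identityʳ h)) ⟩
      2 * h ∎
    where
      h : ℕ
      h = suc (2 * k) C k

  central-step : ∀ k → (2 * suc k) C suc k ≡ 2 * ((2 * k) C k + (2 * k) C suc k)
  central-step k = trans (central-halving k) (cong (2 *_) (trans (odd-symmetry k) (pascal (2 * k) k)))

  -- The interior terms C(N, i+1)·C(N, N-1-i), i ≤ N-2, of Vandermonde's sum for C(2N, N).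
  interior : ℕ → ℕ → ℕ
  interior r i = (suc (suc r) C suc i) * (suc (suc r) C (suc r ∸ i))

  central-split : ∀ r → (2 * suc (suc r)) C suc (suc r) ≡ 2 + sumTo r (interior r)
  central-split r = begin
      (2 * N) C N
    ≡⟨ cong (λ x → (N + x) C N) (+-identityʳ N) ⟩
      (N + N) C N
    ≡⟨ vandermonde N N N ⟩
      1 * (N C N) + sumTo (suc r) (λ i → (N C suc i) * (N C (suc r ∸ i)))
    ≡⟨ cong (1 * (N C N) +_) (sumTo-last r (λ i → (N C suc i) * (N C (suc r ∸ i)))) ⟩
      1 * (N C N) + (sumTo r (interior r) + (N C N) * (N C (r ∸ r)))
    ≡⟨ cong₂ (λ x y → 1 * x + (sumTo r (interior r) + x * (N C y))) (nCn≡1 N) (n∸n≡0 r) ⟩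
      1 * 1 + (sumTo r (interior r) + 1 * 1)
    ≡⟨ solve 1 (λ s → con 1 :* con 1 :+ (s :+ con 1 :* con 1) := con 2 :+ s) refl (sumTo r (interior r)) ⟩
      2 + sumTo r (interior r) ∎
    where
      N : ℕ
      N = suc (suc r)

  ≥2-form : ∀ {n} → 2 ≤ n → ∃ λ r → n ≡ suc (suc r)
  ≥2-form {suc (suc r)} _ = r , refl
  ≥2-form {suc zero} (s≤s ())

  prime-≥2 : ∀ {p} → Prime p → ∃ λ q → p ≡ suc (suc q)
  prime-≥2 {p} pr = ≥2-form (nonTrivial⇒n>1 p {{prime⇒nonTrivial pr}})

  prime-power-≥2 : ∀ {p} → Prime p → ∀ a → ∃ λ r → p ^ suc a ≡ suc (suc r)
  prime-power-≥2 {p} pr a =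
    ≥2-form (*-mono-≤ (nonTrivial⇒n>1 p {{prime⇒nonTrivial pr}}) (m^n>0 p {{prime⇒nonZero pr}} a))

  interior-right-divisible : ∀ {p} → Prime p → ∀ a r → suc (suc r) ≡ p ^ suc a →
    ∀ i → i ≤ r → p ∣ suc (suc r) C (suc r ∸ i)
  interior-right-divisible {p} pr a r N≡ i i≤r =
    subst (λ k → p ∣ suc (suc r) C k) (sym (+-∸-assoc 1 i≤r))
      (prime-divides-binomial pr a (suc (suc r)) (r ∸ i) N≡ (s≤s (s≤s (m∸n≤m r i))))

  central-binomial-mod-p² : ∀ {p} → Prime p → ∀ a → ∃ λ X → (2 * p ^ a) C (p ^ a) ≡ 2 + X * (p * p)
  central-binomial-mod-p² pr zero = 0 , refl
  central-binomial-mod-p² {p} pr (suc a) with prime-power-≥2 pr a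
  ... | r , N≡ with ∣-sumTo r (interior r) p²∣interior
    where
      p²∣interior : ∀ i → i ≤ r → p * p ∣ interior r i
      p²∣interior i i≤r = *-pres-∣ (prime-divides-binomial pr a (suc (suc r)) i (sym N≡) (s≤s (s≤s i≤r)))
                                    (interior-right-divisible pr a r (sym N≡) i i≤r)
  ... | divides X eq = X , (begin
      (2 * p ^ suc a) C (p ^ suc a)
    ≡⟨ cong (λ N → (2 * N) C N) N≡ ⟩
      (2 * suc (suc r)) C suc (suc r)
    ≡⟨ central-split r ⟩
      2 + sumTo r (interior r)
    ≡⟨ cong (2 +_) eq ⟩
      2 + X * (p * p) ∎)

  sole-multiple : ∀ M k → M ∣ suc k → suc k < 2 * M → suc k ≡ M
  sole-multiple M k (divides 1 eq) _ = trans eq (+-identityʳ M)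
  sole-multiple M k (divides (suc (suc q)) eq) k<2M =
    ⊥-elim (<⇒≱ k<2M (subst (2 * M ≤_) (sym eq) (*-monoˡ-≤ M (m≤m+n 2 q))))

  -- For p = 2 and N = 2^(a+1) this improves to C(2N, N) ≡ 6 (mod 8): the middle interior
  -- term is C(N, N/2)² ≡ 2² (mod 8), while every other one has factors divisible by 4 and 2.
  central-binomial-mod-8 : ∀ a → ∃ λ X → (2 * 2 ^ suc a) C (2 ^ suc a) ≡ 6 + X * 8
  central-binomial-mod-8 zero = 0 , refl
  central-binomial-mod-8 (suc a) = 2 * Y + 2 * Y * Y + t , (begin
      (2 * 2 ^ suc (suc a)) C (2 ^ suc (suc a))
    ≡⟨ cong (λ N → (2 * N) C N) N≡ ⟩
      (2 * suc (suc r)) C suc (suc r)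
    ≡⟨ central-split r ⟩
      2 + sumTo r (interior r)
    ≡⟨ cong (2 +_) sum≡ ⟩
      2 + ((suc (suc r) C suc m₀) * (suc (suc r) C (suc r ∸ m₀)) + t * 8)
    ≡⟨ cong (λ k → 2 + ((suc (suc r) C suc m₀) * (suc (suc r) C k) + t * 8)) r+1∸m₀ ⟩
      2 + ((suc (suc r) C suc m₀) * (suc (suc r) C suc m₀) + t * 8)
    ≡⟨ cong (λ c → 2 + (c * c + t * 8)) (trans (sym (cong₂ _C_ N≡ M≡)) middle≡) ⟩
      2 + ((2 + Y * 4) * (2 + Y * 4) + t * 8)
    ≡⟨ solve 2 (λ Y t → con 2 :+ ((con 2 :+ Y :* con 4) :* (con 2 :+ Y :* con 4) :+ t :* con 8)
                      := con 6 :+ (con 2 :* Y :+ con 2 :* Y :* Y :+ t) :* con 8) refl Y t ⟩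
      6 + (2 * Y + 2 * Y * Y + t) * 8 ∎)
    where
      M m₀ r : ℕ
      M = 2 ^ suc a
      m₀ = suc (proj₁ (prime-power-≥2 prime[2] a))
      M≡ : M ≡ suc m₀
      M≡ = proj₂ (prime-power-≥2 prime[2] a)
      r = m₀ + m₀
      N≡ : 2 * M ≡ suc (suc r)
      N≡ = trans (cong (2 *_) M≡) (solve 1 (λ m → con 2 :* (con 1 :+ m) := con 2 :+ (m :+ m)) refl m₀)
      r+1∸m₀ : suc r ∸ m₀ ≡ suc m₀
      r+1∸m₀ = trans (+-∸-assoc 1 (m≤m+n m₀ m₀)) (cong suc (m+n∸m≡n m₀ m₀))
      Y : ℕ
      Y = proj₁ (central-binomial-mod-p² prime[2] (suc a))
      middle≡ : (2 * M) C M ≡ 2 + Y * 4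
      middle≡ = proj₂ (central-binomial-mod-p² prime[2] (suc a))
      8∣others : ∀ i → i ≤ r → i ≢ m₀ → 8 ∣ interior r i
      8∣others i i≤r i≢m₀ = *-pres-∣ {4} {_} {2}
        (prime-power-binomial prime[2] a 2 (suc (suc r)) (suc i) (∣-reflexive N≡)
          (λ M∣i+1 → i≢m₀ (suc-injective (trans (sole-multiple M i M∣i+1
                                                   (subst (suc i <_) (sym N≡) (s≤s (s≤s i≤r)))) M≡))))
        (interior-right-divisible prime[2] (suc a) r (sym N≡) i i≤r)
      t : ℕ
      t = proj₁ (sumTo-single r (interior r) m₀ (m≤m+n m₀ m₀) 8∣others)
      sum≡ : sumTo r (interior r) ≡ interior r m₀ + t * 8
      sum≡ = proj₂ (sumTo-single r (interior r) m₀ (m≤m+n m₀ m₀) 8∣others)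

  halve-mod-odd : ∀ {q h X} → ¬ 2 ∣ q → 2 * h ≡ 2 + X * q → ∃ λ Y → h ≡ 1 + Y * q
  halve-mod-odd {h = zero} _ ()
  halve-mod-odd {q} {suc h} {X} 2∤q 2h+2≡ = Y , cong suc (*-cancelˡ-≡ h (Y * q) 2 (begin
      2 * h       ≡⟨ 2h≡ ⟩
      X * q       ≡⟨ cong (_* q) (_∣_.equality 2∣X) ⟩
      Y * 2 * q   ≡⟨ solve 2 (λ y q → y :* con 2 :* q := con 2 :* (y :* q)) refl Y q ⟩
      2 * (Y * q) ∎))
    where
      2h≡ : 2 * h ≡ X * q
      2h≡ = +-cancelˡ-≡ 2 _ _ (trans (sym (*-suc 2 h)) 2h+2≡)
      2∣X : 2 ∣ X
      2∣X = [ id , (λ 2∣q → ⊥-elim (2∤q 2∣q)) ]′ (euclidsLemma X q prime[2] (divides h (trans (sym 2h≡) (*-comm 2 h))))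
      Y : ℕ
      Y = _∣_.quotient 2∣X

  even-prime : ∀ {p} → Prime p → 2 ∣ p → p ≡ 2
  even-prime pr 2∣p with prime⇒irreducible pr 2∣p
  ... | inj₁ ()
  ... | inj₂ 2≡p = sym 2≡p

  odd-prime-square : ∀ {p} → Prime p → p ≢ 2 → ¬ 2 ∣ p * p
  odd-prime-square {p} pr p≢2 2∣p² = p≢2 (even-prime pr (reduce (euclidsLemma p p prime[2] 2∣p²)))

  double-half-central : ∀ p a n → suc n ≡ p ^ suc a → 2 * (suc (2 * n) C n) ≡ (2 * p ^ suc a) C (p ^ suc a)
  double-half-central p a n N≡ = trans (sym (central-halving n)) (cong (λ N → (2 * N) C N) N≡)

  half-central-odd : ∀ {p} → Prime p → p ≢ 2 → ∀ a n → suc n ≡ p ^ suc a →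
    ∃ λ Y → suc (2 * n) C n ≡ 1 + Y * (p * p)
  half-central-odd {p} pr p≢2 a n N≡ =
    halve-mod-odd {h = suc (2 * n) C n} {X} (odd-prime-square pr p≢2) (trans (double-half-central p a n N≡) central≡)
    where
      X : ℕ
      X = proj₁ (central-binomial-mod-p² pr (suc a))
      central≡ : (2 * p ^ suc a) C (p ^ suc a) ≡ 2 + X * (p * p)
      central≡ = proj₂ (central-binomial-mod-p² pr (suc a))

  half-central-two : ∀ a n → suc n ≡ 2 ^ suc a → ∃ λ Y → suc (2 * n) C n ≡ 3 + Y * 4
  half-central-two a n N≡ = X , *-cancelˡ-≡ (suc (2 * n) C n) (3 + X * 4) 2 (begin
      2 * (suc (2 * n) C n)       ≡⟨ double-half-central 2 a n N≡ ⟩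
      (2 * 2 ^ suc a) C (2 ^ suc a) ≡⟨ central≡ ⟩
      6 + X * 8                   ≡⟨ solve 1 (λ x → con 6 :+ x :* con 8 := con 2 :* (con 3 :+ x :* con 4)) refl X ⟩
      2 * (3 + X * 4)             ∎)
    where
      X : ℕ
      X = proj₁ (central-binomial-mod-8 a)
      central≡ : (2 * 2 ^ suc a) C (2 ^ suc a) ≡ 6 + X * 8
      central≡ = proj₂ (central-binomial-mod-8 a)

  -- Freshman's dream: (1 + x)^p ≡ 1 + x^p (mod p), as p divides C(p, i) for 0 < i < p.
  freshman : ∀ {p} → Prime p → ∀ x → ∃ λ t → (1 + x) ^ p ≡ 1 + x ^ p + t * p
  freshman {p} pr x with prime-≥2 pr
  ... | q , refl = t , (begin
      (1 + x) ^ p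
    ≡⟨ binomial-theorem x p ⟩
      B 0 + sumTo (suc q) (λ i → B (suc i))
    ≡⟨ cong (B 0 +_) (sumTo-last q (λ i → B (suc i))) ⟩
      B 0 + (sumTo q (λ i → B (suc i)) + B p)
    ≡⟨ cong₂ (λ s c → B 0 + (s + c * x ^ p)) (_∣_.equality p∣interior) (nCn≡1 p) ⟩
      1 * 1 + (t * p + 1 * x ^ p)
    ≡⟨ solve 3 (λ t p y → con 1 :* con 1 :+ (t :* p :+ con 1 :* y) := con 1 :+ y :+ t :* p) refl t p (x ^ p) ⟩
      1 + x ^ p + t * p ∎)
    where
      B : ℕ → ℕ
      B i = (p C i) * x ^ i
      p∣interior : p ∣ sumTo q (λ i → B (suc i))
      p∣interior = ∣-sumTo q _ (λ i i≤q → ∣m⇒∣m*n (x ^ suc i)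
                     (prime-divides-binomial pr 0 p i (sym (*-identityʳ p)) (s≤s (s≤s i≤q))))
      t : ℕ
      t = _∣_.quotient p∣interior

  fermat-ℕ : ∀ {p} → Prime p → ∀ x → ∃ λ t → x ^ p ≡ x + t * p
  fermat-ℕ {p} pr zero with prime-≥2 pr
  ... | q , refl = 0 , refl
  fermat-ℕ {p} pr (suc x) = t₁ + t₂ , (begin
      (1 + x) ^ p                ≡⟨ proj₂ (freshman pr x) ⟩
      1 + x ^ p + t₁ * p         ≡⟨ cong (λ y → 1 + y + t₁ * p) (proj₂ (fermat-ℕ pr x)) ⟩
      1 + (x + t₂ * p) + t₁ * p  ≡⟨ solve 4 (λ x t₁ t₂ p → con 1 :+ (x :+ t₂ :* p) :+ t₁ :* p
                                               := con 1 :+ x :+ (t₁ :+ t₂) :* p) refl x t₁ t₂ p ⟩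
      suc x + (t₁ + t₂) * p      ∎)
    where
      t₁ t₂ : ℕ
      t₁ = proj₁ (freshman pr x)
      t₂ = proj₁ (fermat-ℕ pr x)

module IntegerCongruences where

  open import Data.Nat as ℕ using (ℕ; zero; suc)
  import Data.Nat.Properties as ℕ
  import Data.Nat.Divisibility as ℕ
  open import Data.Nat.Primality using (Prime; euclidsLemma; prime⇒nonZero; ¬prime[1])
  open import Data.Integer using (ℤ; +_; _+_; _-_; _*_; _^_; -_; ∣_∣)
  open import Data.Integer.Properties using (pos-+; pos-*; abs-*; ^-distribˡ-+-*; ^-*-assoc; *-identityʳ)
  open import Data.Integer.DivMod using (_%ℕ_; _/ℕ_; a≡a%ℕn+[a/ℕn]*n)
  import Data.Integer.Divisibility.Signed as Signed
  open import Data.Integer.Solver using (module +-*-Solver)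
  open +-*-Solver using (solve; _:=_; _:+_; _:-_; _:*_; :-_; con)
  open import Data.Product using (∃; _,_; proj₁; proj₂)
  open import Data.Sum using ([_,_]′)
  open import Function using (id)
  open import Data.Empty using (⊥-elim)
  open import Relation.Nullary using (¬_; yes; no)
  open import Relation.Binary.PropositionalEquality
  open ≡-Reasoning
  open import Defs using (δ2)
  open import Data.Nat.Combinatorics using (_C_)
  open BinomialCoefficients using (prime-≥2; prime-power-≥2; fermat-ℕ; half-central-odd; half-central-two)
  import Data.Nat.Solver as NatSolver
  module NS = NatSolver.+-*-Solver

  infix 4 _≡_mod_
  record _≡_mod_ (a b n : ℤ) : Set where
    constructor congruent
    field
      quotient : ℤ
      equality : a ≡ b + quotient * n

  mod-refl : ∀ {n} a → a ≡ a mod n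
  mod-refl {n} a = congruent (+ 0) (solve 2 (λ a n → a := a :+ con (+ 0) :* n) refl a n)

  mod-sym : ∀ {n a b} → a ≡ b mod n → b ≡ a mod n
  mod-sym {n} {a} {b} (congruent q refl) = congruent (- q) (solve 3 (λ b q n → b := b :+ q :* n :+ (:- q) :* n) refl b q n)

  mod-trans : ∀ {n a b c} → a ≡ b mod n → b ≡ c mod n → a ≡ c mod n
  mod-trans {n} {c = c} (congruent q₁ refl) (congruent q₂ refl) =
    congruent (q₂ + q₁) (solve 4 (λ c q₁ q₂ n → c :+ q₂ :* n :+ q₁ :* n := c :+ (q₂ :+ q₁) :* n) refl c q₁ q₂ n)

  mod-+ : ∀ {n a b c d} → a ≡ b mod n → c ≡ d mod n → a + c ≡ b + d mod n
  mod-+ {n} {b = b} {d = d} (congruent q₁ refl) (congruent q₂ refl) =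
    congruent (q₁ + q₂)
      (solve 5 (λ b d q₁ q₂ n → b :+ q₁ :* n :+ (d :+ q₂ :* n) := b :+ d :+ (q₁ :+ q₂) :* n) refl b d q₁ q₂ n)

  mod-* : ∀ {n a b c d} → a ≡ b mod n → c ≡ d mod n → a * c ≡ b * d mod n
  mod-* {n} {b = b} {d = d} (congruent q₁ refl) (congruent q₂ refl) =
    congruent (b * q₂ + q₁ * d + q₁ * q₂ * n)
      (solve 5 (λ b d q₁ q₂ n → (b :+ q₁ :* n) :* (d :+ q₂ :* n)
                            := b :* d :+ (b :* q₂ :+ q₁ :* d :+ q₁ :* q₂ :* n) :* n) refl b d q₁ q₂ n)

  mod-^ : ∀ {n a b} k → a ≡ b mod n → a ^ k ≡ b ^ k mod n
  mod-^ zero _ = mod-refl (+ 1)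
  mod-^ (suc k) a≡b = mod-* a≡b (mod-^ k a≡b)

  mod-from-ℕ : ∀ {a b X q} → a ≡ b ℕ.+ X ℕ.* q → + a ≡ + b mod + q
  mod-from-ℕ {a} {b} {X} {q} refl = congruent (+ X) (trans (pos-+ b (X ℕ.* q)) (cong (λ y → + b + y) (pos-* X q)))

  pos-^ : ∀ n k → (+ n) ^ k ≡ + (n ℕ.^ k)
  pos-^ n zero = refl
  pos-^ n (suc k) = trans (cong (+ n *_) (pos-^ n k)) (sym (pos-* n (n ℕ.^ k)))

  ≡⇒mod : ∀ {n a b} → a ≡ b → a ≡ b mod n
  ≡⇒mod {b = b} refl = mod-refl b

  -- Fermat's little theorem over ℤ:  m^p ≡ m (mod p), by reducing m to its residue r ≥ 0.
  fermat-ℤ : ∀ {p} → Prime p → ∀ m → m ^ p ≡ m mod + p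
  fermat-ℤ {p} pr m =
    mod-trans (mod-^ p m≡r)
      (mod-trans (≡⇒mod (pos-^ r p))
        (mod-trans (mod-from-ℕ {X = proj₁ (fermat-ℕ pr r)} (proj₂ (fermat-ℕ pr r))) (mod-sym m≡r)))
    where
      instance _ = prime⇒nonZero pr
      r : ℕ
      r = m %ℕ p
      m≡r : m ≡ + r mod + p
      m≡r = congruent (m /ℕ p) (a≡a%ℕn+[a/ℕn]*n m p)

  cancel-mod-prime : ∀ {p} → Prime p → ∀ {m x y} → ¬ p ℕ.∣ ∣ m ∣ → m * x ≡ m * y mod + p → x ≡ y mod + p
  cancel-mod-prime {p} pr {m} {x} {y} p∤m (congruent t mx≡) =
    congruent s (trans (solve 2 (λ x y → x := y :+ (x :- y)) refl x y) (cong (λ z → y + z) x-y≡))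
    where
      m[x-y]≡ : m * (x - y) ≡ t * + p
      m[x-y]≡ = trans (solve 3 (λ m x y → m :* (x :- y) := m :* x :- m :* y) refl m x y)
                  (trans (cong (_- m * y) mx≡) (solve 3 (λ a t p → a :+ t :* p :- a := t :* p) refl (m * y) t (+ p)))
      p∣|m||x-y| : p ℕ.∣ ∣ m ∣ ℕ.* ∣ x - y ∣
      p∣|m||x-y| = ℕ.divides ∣ t ∣ (trans (sym (abs-* m (x - y))) (trans (cong ∣_∣ m[x-y]≡) (abs-* t (+ p))))
      p∣x-y : Signed._∣_ (+ p) (x - y)
      p∣x-y = Signed.∣ᵤ⇒∣
                ([ (λ p∣m → ⊥-elim (p∤m p∣m)) , id ]′ (euclidsLemma ∣ m ∣ ∣ x - y ∣ pr p∣|m||x-y|))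
      s : ℤ
      s = Signed._∣_.quotient p∣x-y
      x-y≡ : x - y ≡ s * + p
      x-y≡ = Signed._∣_.equality p∣x-y

  -- Fermat's little theorem:  m^(p-1) ≡ 1 (mod p)  when p ∤ m, cancelling m from m^p ≡ m.
  fermat-little : ∀ {p} → Prime p → ∀ m → ¬ p ℕ.∣ ∣ m ∣ → m ^ (p ℕ.∸ 1) ≡ + 1 mod + p
  fermat-little {p} pr m p∤m with prime-≥2 pr
  ... | q , refl = cancel-mod-prime pr {m} p∤m (mod-trans (fermat-ℤ pr m) (≡⇒mod (sym (*-identityʳ m))))

  binomial-first-order : ∀ y k → ∃ λ z → (+ 1 + y) ^ k ≡ + 1 + + k * y + y * y * z
  binomial-first-order y zero = + 0 , solve 1 (λ y → con (+ 1) := con (+ 1) :+ con (+ 0) :* y :+ y :* y :* con (+ 0)) refl y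
  binomial-first-order y (suc k) = + k + z + z * y , (begin
      (+ 1 + y) * (+ 1 + y) ^ k
    ≡⟨ cong ((+ 1 + y) *_) (proj₂ (binomial-first-order y k)) ⟩
      (+ 1 + y) * (+ 1 + + k * y + y * y * z)
    ≡⟨ solve 3 (λ y k z → (con (+ 1) :+ y) :* (con (+ 1) :+ k :* y :+ y :* y :* z)
                        := con (+ 1) :+ (con (+ 1) :+ k) :* y :+ y :* y :* (k :+ z :+ z :* y)) refl y (+ k) z ⟩
      + 1 + (+ 1 + + k) * y + y * y * (+ k + z + z * y)
    ≡⟨ cong (λ c → + 1 + c * y + y * y * (+ k + z + z * y)) (sym (pos-+ 1 k)) ⟩
      + 1 + + suc k * y + y * y * (+ k + z + z * y) ∎)
    where
      z : ℤ
      z = proj₁ (binomial-first-order y k)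

  power-lift : ∀ {u} k → u ≡ + 1 mod + k → u ^ k ≡ + 1 mod (+ k * + k)
  power-lift k (congruent s refl) = congruent (s + s * s * z) (begin
      (+ 1 + s * + k) ^ k
    ≡⟨ proj₂ (binomial-first-order (s * + k) k) ⟩
      + 1 + + k * (s * + k) + s * + k * (s * + k) * z
    ≡⟨ solve 3 (λ k s z → con (+ 1) :+ k :* (s :* k) :+ s :* k :* (s :* k) :* z
                        := con (+ 1) :+ (s :+ s :* s :* z) :* (k :* k)) refl (+ k) s z ⟩
      + 1 + (s + s * s * z) * (+ k * + k) ∎)
    where
      z : ℤ
      z = proj₁ (binomial-first-order (s * + k) k)

  exponent-step : ∀ q n → suc q ℕ.* suc n ℕ.∸ 1 ≡ q ℕ.+ n ℕ.* suc q
  exponent-step q n = NS.solve 2 (λ q n → n NS.:+ q NS.:* (NS.con 1 NS.:+ n) NS.:= q NS.:+ n NS.:* (NS.con 1 NS.:+ q)) refl q n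

  -- Euler-type lifting:  m^(p^(a+1) - 1) ≡ m^(p-1) (mod p²)  when m^(p-1) ≡ 1 (mod p),
  -- because p^(a+2) - 1 = (p-1) + (p^(a+1) - 1)·p  and  (m^(p-1))^p ≡ 1 (mod p²).
  euler-lift : ∀ {p} → Prime p → ∀ m → m ^ (p ℕ.∸ 1) ≡ + 1 mod + p → ∀ a →
    m ^ (p ℕ.^ suc a ℕ.∸ 1) ≡ m ^ (p ℕ.∸ 1) mod (+ p * + p)
  euler-lift {p} pr m u≡1 zero = ≡⇒mod (cong (λ e → m ^ (e ℕ.∸ 1)) (ℕ.*-identityʳ p))
  euler-lift {p} pr m u≡1 (suc a) with prime-≥2 pr | prime-power-≥2 pr a
  ... | q , refl | r , N≡ =
    mod-trans (≡⇒mod exponent≡) (mod-trans (mod-* (mod-refl u) (mod-trans (mod-^ p (e≡)) (power-lift p u≡1)))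
                                            (≡⇒mod (*-identityʳ u)))
    where
      u : ℤ
      u = m ^ suc q
      exponent≡ : m ^ (p ℕ.^ suc (suc a) ℕ.∸ 1) ≡ u * (m ^ suc r) ^ p
      exponent≡ = begin
          m ^ (p ℕ.* p ℕ.^ suc a ℕ.∸ 1)       ≡⟨ cong (λ N → m ^ (p ℕ.* N ℕ.∸ 1)) N≡ ⟩
          m ^ (p ℕ.* suc (suc r) ℕ.∸ 1)       ≡⟨ cong (m ^_) (exponent-step (suc q) (suc r)) ⟩
          m ^ (suc q ℕ.+ suc r ℕ.* p)         ≡⟨ ^-distribˡ-+-* m (suc q) (suc r ℕ.* p) ⟩
          u * m ^ (suc r ℕ.* p)               ≡⟨ cong (u *_) (^-*-assoc m (suc r) p) ⟨
          u * (m ^ suc r) ^ p                 ∎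
      e≡ : m ^ suc r ≡ u mod (+ p * + p)
      e≡ = subst (λ N → m ^ (N ℕ.∸ 1) ≡ u mod (+ p * + p)) N≡ (euler-lift pr m u≡1 a)

  -- The final cancellation: if h ≡ 1 + Pδ and M ≡ u (mod P²) with u ≡ 1 (mod P), then
  -- h + (u - 2 - Pδ)·M ≡ 0 (mod P²), since 1 + Pδ + (u - 2 - Pδ)·u = (u - 1)(u - 1 - Pδ).
  key-cancellation : ∀ {P δ h u M} → h ≡ + 1 + P * δ mod (P * P) → M ≡ u mod (P * P) → u ≡ + 1 mod P →
    h + (u - + 2 - P * δ) * M ≡ + 0 mod (P * P)
  key-cancellation {P} {δ} h≡ M≡u (congruent t refl) =
    mod-trans (mod-+ h≡ (mod-* (mod-refl (u - + 2 - P * δ)) M≡u))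
      (congruent (t * t - δ * t) (solve 3 (λ P δ t →
        con (+ 1) :+ P :* δ :+ ((con (+ 1) :+ t :* P) :- con (+ 2) :- P :* δ) :* (con (+ 1) :+ t :* P)
          := con (+ 0) :+ (t :* t :- δ :* t) :* (P :* P)) refl P δ t))
    where
      u : ℤ
      u = + 1 + t * P

  δ2-odd : ∀ {p} → p ≢ 2 → δ2 p ≡ + 0
  δ2-odd {zero} _ = refl
  δ2-odd {suc zero} _ = refl
  δ2-odd {suc (suc zero)} p≢2 = ⊥-elim (p≢2 refl)
  δ2-odd {suc (suc (suc p))} _ = refl

  half-central-mod : ∀ {p} → Prime p → ∀ a n → suc n ≡ p ℕ.^ suc a →
    + (suc (2 ℕ.* n) C n) ≡ + 1 + + p * δ2 p mod (+ p * + p)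
  half-central-mod {p} pr a n N≡ with p ℕ.≟ 2
  ... | yes refl = mod-from-ℕ {X = proj₁ (half-central-two a n N≡)} (proj₂ (half-central-two a n N≡))
  ... | no p≢2 = subst₂ (λ b P → + (suc (2 ℕ.* n) C n) ≡ b mod P)
                    (sym (trans (cong (λ d → + 1 + + p * d) (δ2-odd p≢2))
                                (solve 1 (λ p → con (+ 1) :+ p :* con (+ 0) := con (+ 1)) refl (+ p))))
                    (pos-* p p)
                    (mod-from-ℕ {X = proj₁ (half-central-odd pr p≢2 a n N≡)} (proj₂ (half-central-odd pr p≢2 a n N≡)))

  prime-∤-power : ∀ {p} → Prime p → ∀ {m} → ¬ p ℕ.∣ ∣ m ∣ → ∀ k → ¬ p ℕ.∣ ∣ m ^ k ∣
  prime-∤-power pr p∤m zero p∣1 = ¬prime[1] (subst Prime (ℕ.∣1⇒≡1 p∣1) pr)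
  prime-∤-power {p} pr {m} p∤m (suc k) p∣m^k+1 =
    [ p∤m , prime-∤-power pr p∤m k ]′ (euclidsLemma ∣ m ∣ ∣ m ^ k ∣ pr (subst (p ℕ.∣_) (abs-* m (m ^ k)) p∣m^k+1))

module IntegerEmbedding where

  open import Data.Nat as ℕ using (ℕ; zero; suc)
  import Data.Nat.Properties as ℕ
  open import Data.Integer as ℤ using (ℤ; +_; -[1+_])
  open import Data.Integer.Properties using (pos-+; pos-*)
  open import Data.Integer.Solver using (module +-*-Solver)
  open +-*-Solver using (solve; _:=_; _:+_; _:*_; :-_; con)
  open import Data.Rational using (ℚ; _/_; 1ℚ; _+_; _*_; -_; _-_; fromℚᵘ)
  open import Data.Rational.Properties using (toℚᵘ-injective; toℚᵘ-homo-+; toℚᵘ-homo-*; toℚᵘ-homo‿-;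
    toℚᵘ-fromℚᵘ; fromℚᵘ-cong; *-identityʳ; *-identityˡ; *-assoc; *-comm)
  import Data.Rational.Unnormalised as ℚᵘ
  import Data.Rational.Unnormalised.Properties as ℚᵘ
  open import Data.Empty using (⊥-elim)
  open import Relation.Binary.PropositionalEquality
  open ≡-Reasoning
  open import Defs using (_÷ℤ_)

  fromℚᵘ-+ : ∀ x y → fromℚᵘ (x ℚᵘ.+ y) ≡ fromℚᵘ x + fromℚᵘ y
  fromℚᵘ-+ x y = toℚᵘ-injective (ℚᵘ.≃-trans (toℚᵘ-fromℚᵘ (x ℚᵘ.+ y))
    (ℚᵘ.≃-sym (ℚᵘ.≃-trans (toℚᵘ-homo-+ (fromℚᵘ x) (fromℚᵘ y))
                          (ℚᵘ.+-cong (toℚᵘ-fromℚᵘ x) (toℚᵘ-fromℚᵘ y)))))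

  fromℚᵘ-* : ∀ x y → fromℚᵘ (x ℚᵘ.* y) ≡ fromℚᵘ x * fromℚᵘ y
  fromℚᵘ-* x y = toℚᵘ-injective (ℚᵘ.≃-trans (toℚᵘ-fromℚᵘ (x ℚᵘ.* y))
    (ℚᵘ.≃-sym (ℚᵘ.≃-trans (toℚᵘ-homo-* (fromℚᵘ x) (fromℚᵘ y))
                          (ℚᵘ.*-cong (toℚᵘ-fromℚᵘ x) (toℚᵘ-fromℚᵘ y)))))

  fromℚᵘ-neg : ∀ x → fromℚᵘ (ℚᵘ.- x) ≡ - fromℚᵘ x
  fromℚᵘ-neg x = toℚᵘ-injective (ℚᵘ.≃-trans (toℚᵘ-fromℚᵘ (ℚᵘ.- x))
    (ℚᵘ.≃-sym (ℚᵘ.≃-trans (toℚᵘ-homo‿- (fromℚᵘ x)) (ℚᵘ.-‿cong (toℚᵘ-fromℚᵘ x)))))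

  ι : ℤ → ℚ
  ι z = z / 1

  ι-+ : ∀ a b → ι (a ℤ.+ b) ≡ ι a + ι b
  ι-+ a b = trans (fromℚᵘ-cong {ℚᵘ.mkℚᵘ (a ℤ.+ b) 0} {ℚᵘ.mkℚᵘ a 0 ℚᵘ.+ ℚᵘ.mkℚᵘ b 0} (ℚᵘ.*≡* cross))
                  (fromℚᵘ-+ (ℚᵘ.mkℚᵘ a 0) (ℚᵘ.mkℚᵘ b 0))
    where
      cross : (a ℤ.+ b) ℤ.* + 1 ≡ (a ℤ.* + 1 ℤ.+ b ℤ.* + 1) ℤ.* + 1
      cross = solve 2 (λ a b → (a :+ b) :* con (+ 1) := (a :* con (+ 1) :+ b :* con (+ 1)) :* con (+ 1)) refl a b

  ι-* : ∀ a b → ι (a ℤ.* b) ≡ ι a * ι b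
  ι-* a b = fromℚᵘ-* (ℚᵘ.mkℚᵘ a 0) (ℚᵘ.mkℚᵘ b 0)

  ι-- : ∀ a b → ι (a ℤ.- b) ≡ ι a - ι b
  ι-- a b = trans (ι-+ a (ℤ.- b)) (cong (λ y → ι a + y) (fromℚᵘ-neg (ℚᵘ.mkℚᵘ b 0)))

  ι-ℕ-+ : ∀ a b → ι (+ (a ℕ.+ b)) ≡ ι (+ a) + ι (+ b)
  ι-ℕ-+ a b = trans (cong ι (pos-+ a b)) (ι-+ (+ a) (+ b))

  ι-ℕ-* : ∀ a b → ι (+ (a ℕ.* b)) ≡ ι (+ a) * ι (+ b)
  ι-ℕ-* a b = trans (cong ι (pos-* a b)) (ι-* (+ a) (+ b))

  ÷ℤ-cancel : ∀ z D → D ≢ + 0 → (z ÷ℤ D) * ι D ≡ ι z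
  ÷ℤ-cancel z (+ zero) D≢0 = ⊥-elim (D≢0 refl)
  ÷ℤ-cancel z (+ suc d) _ =
    trans (sym (fromℚᵘ-* (ℚᵘ.mkℚᵘ z d) (ℚᵘ.mkℚᵘ (+ suc d) 0)))
          (fromℚᵘ-cong {ℚᵘ.mkℚᵘ z d ℚᵘ.* ℚᵘ.mkℚᵘ (+ suc d) 0} {ℚᵘ.mkℚᵘ z 0} (ℚᵘ.*≡* cross))
    where
      cross : z ℤ.* + suc d ℤ.* + 1 ≡ z ℤ.* + suc (d ℕ.* 1)
      cross = trans (solve 2 (λ z D → z :* D :* con (+ 1) := z :* D) refl z (+ suc d))
                    (cong (λ k → z ℤ.* + suc k) (sym (ℕ.*-identityʳ d)))
  ÷ℤ-cancel z -[1+ d ] _ =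
    trans (sym (fromℚᵘ-* (ℚᵘ.mkℚᵘ (ℤ.- z) d) (ℚᵘ.mkℚᵘ -[1+ d ] 0)))
          (fromℚᵘ-cong {ℚᵘ.mkℚᵘ (ℤ.- z) d ℚᵘ.* ℚᵘ.mkℚᵘ -[1+ d ] 0} {ℚᵘ.mkℚᵘ z 0} (ℚᵘ.*≡* cross))
    where
      cross : ℤ.- z ℤ.* -[1+ d ] ℤ.* + 1 ≡ z ℤ.* + suc (d ℕ.* 1)
      cross = trans (solve 2 (λ z D → (:- z) :* (:- D) :* con (+ 1) := z :* D) refl z (+ suc d))
                    (cong (λ k → z ℤ.* + suc k) (sym (ℕ.*-identityʳ d)))

  solve-for : ∀ x z D → D ≢ + 0 → x * ι D ≡ ι z → x ≡ ι z * ((+ 1) ÷ℤ D)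
  solve-for x z D D≢0 eq = begin
      x                          ≡⟨ *-identityʳ x ⟨
      x * 1ℚ                     ≡⟨ cong (x *_) (trans (*-comm (ι D) _) (÷ℤ-cancel (+ 1) D D≢0)) ⟨
      x * (ι D * ((+ 1) ÷ℤ D))   ≡⟨ *-assoc x (ι D) _ ⟨
      x * ι D * ((+ 1) ÷ℤ D)     ≡⟨ cong (_* ((+ 1) ÷ℤ D)) eq ⟩
      ι z * ((+ 1) ÷ℤ D)         ∎

  ÷ℤ-as-product : ∀ z D → D ≢ + 0 → z ÷ℤ D ≡ ι z * ((+ 1) ÷ℤ D)
  ÷ℤ-as-product z D D≢0 = solve-for (z ÷ℤ D) z D D≢0 (÷ℤ-cancel z D D≢0)

  module Weights (m : ℤ) (m^k≢0 : ∀ k → m ℤ.^ k ≢ + 0) where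

    W : ℕ → ℚ
    W k = (+ 1) ÷ℤ (m ℤ.^ k)

    term : ∀ z k → z ÷ℤ (m ℤ.^ k) ≡ ι z * W k
    term z k = ÷ℤ-as-product z (m ℤ.^ k) (m^k≢0 k)

    W-inverse : ∀ k → ι (m ℤ.^ k) * W k ≡ 1ℚ
    W-inverse k = trans (*-comm (ι (m ℤ.^ k)) (W k)) (÷ℤ-cancel (+ 1) (m ℤ.^ k) (m^k≢0 k))

    W-step : ∀ k → W k ≡ ι m * W (suc k)
    W-step k = sym (trans (solve-for (ι m * W (suc k)) (+ 1) (m ℤ.^ k) (m^k≢0 k) (begin
        ι m * W (suc k) * ι (m ℤ.^ k)   ≡⟨ *-assoc (ι m) (W (suc k)) (ι (m ℤ.^ k)) ⟩
        ι m * (W (suc k) * ι (m ℤ.^ k)) ≡⟨ cong (ι m *_) (*-comm (W (suc k)) (ι (m ℤ.^ k))) ⟩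
        ι m * (ι (m ℤ.^ k) * W (suc k)) ≡⟨ *-assoc (ι m) (ι (m ℤ.^ k)) (W (suc k)) ⟨
        ι m * ι (m ℤ.^ k) * W (suc k)   ≡⟨ cong (_* W (suc k)) (ι-* m (m ℤ.^ k)) ⟨
        ι (m ℤ.^ suc k) * W (suc k)     ≡⟨ W-inverse (suc k) ⟩
        1ℚ                              ∎)) (*-identityˡ (W k)))

module Telescoping where

  open import Data.Nat as ℕ using (ℕ; zero; suc)
  open import Data.Nat.Combinatorics using (_C_)
  open import Data.Integer as ℤ using (ℤ; +_)
  open import Data.Rational using (ℚ; 0ℚ; 1ℚ; _+_; _*_; _-_)
  open import Data.Rational.Properties using (*-distribˡ-+)
  open import Data.Rational.Solver using (module +-*-Solver)
  open +-*-Solver using (solve; _:=_; _:+_; _:-_; _:*_; con)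
  open import Relation.Binary.PropositionalEquality
  open ≡-Reasoning
  open import Defs using (_÷ℤ_; sumFrom1)
  open BinomialCoefficients using (central-step; central-halving)
  open IntegerEmbedding

  two half : ℚ
  two = ι (+ 2)
  half = (+ 1) ÷ℤ (+ 2)

  telescoping : ∀ (c d W : ℕ → ℚ) M → c 1 ≡ two → (∀ k → c (suc k) ≡ two * (c k + d k)) →
    (∀ k → W k ≡ M * W (suc k)) → ∀ n →
    two * sumFrom1 n (λ k → d k * W k) ≡ (M - two) * sumFrom1 n (λ k → c k * W k) - two * W 0 + c (suc n) * W n
  telescoping c d W M c₁≡ c-step W-step zero = begin
      two * 0ℚ
    ≡⟨ solve 2 (λ M w → con two :* con 0ℚ := (M :- con two) :* con 0ℚ :- con two :* w :+ con two :* w) refl M (W 0) ⟩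
      (M - two) * 0ℚ - two * W 0 + two * W 0
    ≡⟨ cong (λ x → (M - two) * 0ℚ - two * W 0 + x * W 0) (sym c₁≡) ⟩
      (M - two) * 0ℚ - two * W 0 + c 1 * W 0 ∎
  telescoping c d W M c₁≡ c-step W-step (suc n) = begin
      two * (Sd + d′ * W′)
    ≡⟨ *-distribˡ-+ two Sd (d′ * W′) ⟩
      two * Sd + two * (d′ * W′)
    ≡⟨ cong (_+ two * (d′ * W′)) (telescoping c d W M c₁≡ c-step W-step n) ⟩
      (M - two) * Sc - two * W 0 + c′ * W n + two * (d′ * W′)
    ≡⟨ cong (λ w → (M - two) * Sc - two * W 0 + c′ * w + two * (d′ * W′)) (W-step n) ⟩
      (M - two) * Sc - two * W 0 + c′ * (M * W′) + two * (d′ * W′)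
    ≡⟨ solve 6 (λ M S w₀ c d w → (M :- con two) :* S :- con two :* w₀ :+ c :* (M :* w) :+ con two :* (d :* w)
                   := (M :- con two) :* (S :+ c :* w) :- con two :* w₀ :+ con two :* (c :+ d) :* w)
                 refl M Sc (W 0) c′ d′ W′ ⟩
      (M - two) * (Sc + c′ * W′) - two * W 0 + two * (c′ + d′) * W′
    ≡⟨ cong (λ x → (M - two) * (Sc + c′ * W′) - two * W 0 + x * W′) (sym (c-step (suc n))) ⟩
      (M - two) * (Sc + c′ * W′) - two * W 0 + c (suc (suc n)) * W′ ∎
    where
      Sd Sc c′ d′ W′ : ℚ
      Sd = sumFrom1 n (λ k → d k * W k)
      Sc = sumFrom1 n (λ k → c k * W k)
      c′ = c (suc n)
      d′ = d (suc n)
      W′ = W (suc n)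

  sumFrom1-cong : ∀ n {f g : ℕ → ℚ} → (∀ k → f k ≡ g k) → sumFrom1 n f ≡ sumFrom1 n g
  sumFrom1-cong zero f≡g = refl
  sumFrom1-cong (suc n) f≡g = cong₂ _+_ (sumFrom1-cong n f≡g) (f≡g (suc n))

  c d : ℕ → ℚ
  c k = ι (+ ((2 ℕ.* k) C k))
  d k = ι (+ ((2 ℕ.* k) C suc k))

  c-step : ∀ k → c (suc k) ≡ two * (c k + d k)
  c-step k = trans (cong (λ x → ι (+ x)) (central-step k))
               (trans (ι-ℕ-* 2 ((2 ℕ.* k) C k ℕ.+ (2 ℕ.* k) C suc k))
                      (cong (two *_) (ι-ℕ-+ ((2 ℕ.* k) C k) ((2 ℕ.* k) C suc k))))

  solve-telescoped : ∀ Sd Sc M H w P U E → two * Sd ≡ (M - two) * Sc - two * 1ℚ + (two * H) * w → P * w ≡ 1ℚ →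
    (Sd + (U - 1ℚ)) - ((M - two) * half * Sc + E) ≡ (H + (U - two - E) * P) * w
  solve-telescoped Sd Sc M H w P U E 2Sd≡ Pw≡1 = begin
      (Sd + (U - 1ℚ)) - ((M - two) * half * Sc + E)
    ≡⟨ solve 5 (λ Sd U Sc M E → (Sd :+ (U :- con 1ℚ)) :- ((M :- con two) :* con half :* Sc :+ E)
                   := con half :* (con two :* Sd) :+ (U :- con 1ℚ) :- ((M :- con two) :* con half :* Sc :+ E))
                 refl Sd U Sc M E ⟩
      half * (two * Sd) + (U - 1ℚ) - ((M - two) * half * Sc + E)
    ≡⟨ cong (λ x → half * x + (U - 1ℚ) - ((M - two) * half * Sc + E)) 2Sd≡ ⟩
      half * ((M - two) * Sc - two * 1ℚ + (two * H) * w) + (U - 1ℚ) - ((M - two) * half * Sc + E)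
    ≡⟨ solve 6 (λ M Sc H w U E → con half :* ((M :- con two) :* Sc :- con two :* con 1ℚ :+ (con two :* H) :* w)
                        :+ (U :- con 1ℚ) :- ((M :- con two) :* con half :* Sc :+ E)
                   := H :* w :+ (U :- con two :- E) :* con 1ℚ) refl M Sc H w U E ⟩
      H * w + (U - two - E) * 1ℚ
    ≡⟨ cong (λ x → H * w + (U - two - E) * x) Pw≡1 ⟨
      H * w + (U - two - E) * (P * w)
    ≡⟨ solve 5 (λ H w U E P → H :* w :+ (U :- con two :- E) :* (P :* w)
                   := (H :+ (U :- con two :- E) :* P) :* w) refl H w U E P ⟩
      (H + (U - two - E) * P) * w ∎

  module _ (m : ℤ) (m^k≢0 : ∀ k → m ℤ.^ k ≢ + 0) where
    open Weights m m^k≢0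

    -- Both sums are weighted sums of c and d, related by telescoping; c (n+1) = 2h.
    difference-formula : ∀ n u e →
      (sumFrom1 n (λ k → (+ ((2 ℕ.* k) C suc k)) ÷ℤ (m ℤ.^ k)) + ι (u ℤ.- + 1))
        - (((m ℤ.- + 2) ÷ℤ (+ 2)) * sumFrom1 n (λ k → (+ ((2 ℕ.* k) C k)) ÷ℤ (m ℤ.^ k)) + ι e)
      ≡ (+ (suc (2 ℕ.* n) C n) ℤ.+ (u ℤ.- + 2 ℤ.- e) ℤ.* m ℤ.^ n) ÷ℤ (m ℤ.^ n)
    difference-formula n u e = begin
        (sumFrom1 n (λ k → (+ ((2 ℕ.* k) C suc k)) ÷ℤ (m ℤ.^ k)) + ι (u ℤ.- + 1))
          - (((m ℤ.- + 2) ÷ℤ (+ 2)) * sumFrom1 n (λ k → (+ ((2 ℕ.* k) C k)) ÷ℤ (m ℤ.^ k)) + ι e)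
      ≡⟨ cong₂ (λ x y → (x + ι (u ℤ.- + 1)) - (y + ι e)) (sumFrom1-cong n (λ k → term _ k))
               (cong₂ _*_ (÷ℤ-as-product (m ℤ.- + 2) (+ 2) (λ ())) (sumFrom1-cong n (λ k → term _ k))) ⟩
        (Sd + ι (u ℤ.- + 1)) - (ι (m ℤ.- + 2) * half * Sc + ι e)
      ≡⟨ cong₂ (λ x y → (Sd + x) - (y * half * Sc + ι e)) (ι-- u (+ 1)) (ι-- m (+ 2)) ⟩
        (Sd + (ι u - 1ℚ)) - ((ι m - two) * half * Sc + ι e)
      ≡⟨ solve-telescoped Sd Sc (ι m) H (W n) (ι (m ℤ.^ n)) (ι u) (ι e) 2Sd≡ (W-inverse n) ⟩
        (H + (ι u - two - ι e) * ι (m ℤ.^ n)) * W n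
      ≡⟨ cong (_* W n) ιZ ⟨
        ι Z * W n
      ≡⟨ term Z n ⟨
        Z ÷ℤ (m ℤ.^ n) ∎
      where
        h : ℕ
        h = suc (2 ℕ.* n) C n
        Sd Sc H : ℚ
        Sd = sumFrom1 n (λ k → d k * W k)
        Sc = sumFrom1 n (λ k → c k * W k)
        H = ι (+ h)
        Z : ℤ
        Z = + h ℤ.+ (u ℤ.- + 2 ℤ.- e) ℤ.* m ℤ.^ n
        2Sd≡ : two * Sd ≡ (ι m - two) * Sc - two * 1ℚ + (two * H) * W n
        2Sd≡ = trans (telescoping c d W (ι m) refl c-step W-step n)
                 (cong (λ x → (ι m - two) * Sc - two * 1ℚ + x * W n)
                       (trans (cong (λ x → ι (+ x)) (central-halving n)) (ι-ℕ-* 2 h)))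
        ιZ : ι Z ≡ H + (ι u - two - ι e) * ι (m ℤ.^ n)
        ιZ = trans (ι-+ (+ h) ((u ℤ.- + 2 ℤ.- e) ℤ.* m ℤ.^ n))
               (cong (λ y → H + y) (trans (ι-* (u ℤ.- + 2 ℤ.- e) (m ℤ.^ n))
                 (cong (_* ι (m ℤ.^ n)) (trans (ι-- (u ℤ.- + 2) e) (cong (_- ι e) (ι-- u (+ 2)))))))

open import Defs
open import Data.Nat as ℕ using (ℕ; _^_; _∸_; _>_; zero; suc)
import Data.Nat.Divisibility as ℕ
open import Data.Nat.Primality using (Prime)
open import Data.Nat.Combinatorics using (_C_)
open import Data.Integer as ℤ using (ℤ; +_; -[1+_])
open import Data.Integer.Divisibility as ℤD using ()
open import Data.Integer.Properties using (neg-distribʳ-*; pos-*)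
import Data.Nat.Properties as ℕ
open import Data.Integer.Solver using (module +-*-Solver)
open +-*-Solver using (solve; _:=_; _:+_; _:*_; con)
open import Data.Rational as ℚ using (ℚ; _/_)
open import Data.Product using (∃₂; _×_; _,_; proj₂)
open import Data.Empty using (⊥-elim)
open import Relation.Nullary using (¬_)
open import Relation.Binary.PropositionalEquality
open BinomialCoefficients using (prime-power-≥2)
open IntegerCongruences
open Telescoping using (difference-formula)

p²K≡ : ∀ p K → + 0 ℤ.+ K ℤ.* (+ p ℤ.* + p) ≡ + (p ^ 2) ℤ.* K
p²K≡ p K = trans (solve 2 (λ K P → con (+ 0) :+ K :* P := P :* K) refl K (+ p ℤ.* + p))
                 (cong (ℤ._* K) (trans (sym (pos-* p p)) (cong (λ z → + (p ℕ.* z)) (sym (ℕ.*-identityʳ p)))))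

congruence-from-quotient : ∀ p {q} Z D → ¬ p ℕ.∣ ℤ.∣ D ∣ → Z ≡ + 0 mod (+ p ℤ.* + p) → q ≡ Z ÷ℤ D →
  ∃₂ λ (c : ℤ) (d : ℕ) → ¬ p ℕ.∣ suc d × q ≡ (+ (p ^ 2) ℤ.* c) / suc d
congruence-from-quotient p Z (+ zero) p∤D _ _ = ⊥-elim (p∤D (p ℕ.∣0))
congruence-from-quotient p Z (+ suc d) p∤D (congruent K refl) q≡ =
  K , d , p∤D , trans q≡ (cong (_/ suc d) (p²K≡ p K))
congruence-from-quotient p Z -[1+ d ] p∤D (congruent K refl) q≡ =
  ℤ.- K , d , p∤D , trans q≡ (cong (_/ suc d) (trans (cong ℤ.-_ (p²K≡ p K)) (neg-distribʳ-* (+ (p ^ 2)) K)))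

-- The theorem: the difference of the two sides is (h + (u - 2 - pδ)·m^n)/m^n, whose numerator
-- vanishes mod p² by the congruences for h, u and m^n.
lemma2p1 : (p a : ℕ) → Prime p → a > 0 → (m : ℤ) → ¬ ((+ p) ℤD.∣ m) →
    CongModIn p (+ (p ^ 2))
      (sumFrom1 (p ^ a ∸ 1) (λ k → (+ ((2 ℕ.* k) C (ℕ.suc k))) ÷ℤ (m ℤ.^ k))
        ℚ.+ ℚ._/_ ((m ℤ.^ (p ∸ 1)) ℤ.- + 1) 1)
      ((((m ℤ.- + 2) ÷ℤ (+ 2)) ℚ.* sumFrom1 (p ^ a ∸ 1) (λ k → (+ ((2 ℕ.* k) C k)) ÷ℤ (m ℤ.^ k)))
        ℚ.+ ℚ._/_ ((+ p) ℤ.* δ2 p) 1)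
lemma2p1 p (suc a) pr _ m p∤m =
  congruence-from-quotient p _ (m ℤ.^ n) (prime-∤-power pr p∤m n)
    (key-cancellation (half-central-mod pr a n N≡) (euler-lift pr m u≡1 a) u≡1)
    (difference-formula m m^k≢0 n (m ℤ.^ (p ∸ 1)) (+ p ℤ.* δ2 p))
  where
    n : ℕ
    n = p ^ suc a ∸ 1
    N≡ : suc n ≡ p ^ suc a
    N≡ = trans (cong (λ N → suc (N ∸ 1)) (proj₂ (prime-power-≥2 pr a))) (sym (proj₂ (prime-power-≥2 pr a)))
    u≡1 : m ℤ.^ (p ∸ 1) ≡ + 1 mod + p
    u≡1 = fermat-little pr m p∤m
    m^k≢0 : ∀ k → m ℤ.^ k ≢ + 0
    m^k≢0 k m^k≡0 = prime-∤-power pr p∤m k (subst (λ z → p ℕ.∣ ℤ.∣ z ∣) (sym m^k≡0) (p ℕ.∣0))
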